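{- Let $n$ and $k$ be positive integers with $n\ge 2k\ge 8$, and let $r$ be the remainder of $n-3$ when divided by $k-2$. Then \[ex_{\mathcal{P}}(n,2C_k)\ge \left(3-\frac{1}{k-2}\right)n+\frac{3+r}{k-2}-5+\max\{1-r,0\}.\]
   Context: All graphs are finite and simple. $C_k$ is the cycle on $k$ vertices and $2C_k$ denotes the disjoint union of two copies of $C_k$. For a graph $H$ and integer $n$, $ex_{\mathcal{P}}(n,H)$ denotes the maximum number of edges in a planar graph on $n$ vertices that does not contain $H$ as a subgraph. -}

module Defs where

open import Data.Nat using (ℕ; zero; suc; _∸_; _<ᵇ_; _%_)
open import Data.Fin using (Fin; toℕ)
open import Data.Bool using (Bool; true; false; _∧_; if_then_else_)
open import Data.List using (List; map; allFin; concatMap)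
open import Data.Nat.ListAction using (sum)
open import Data.Product using (_×_; _,_; ∃; Σ; proj₁; proj₂)
open import Data.Sum using (_⊎_; inj₁; inj₂)
open import Data.Integer as ℤ using (ℤ; _*_; _-_; _<_; _≤_; 0ℤ)
open import Relation.Binary.PropositionalEquality using (_≡_; _≢_)
open import Relation.Nullary using (¬_)
open import Function.Definitions using (Injective)

record Graph (n : ℕ) : Set where
  field
    adj   : Fin n → Fin n → Bool
    sym   : ∀ i j → adj i j ≡ adj j i
    irrefl : ∀ i → adj i i ≡ false
open Graph public

edgeCount : ∀ {n} → Graph n → ℕ
edgeCount {n} G =
  sum (concatMap (λ i → map (λ j →
        if (toℕ i <ᵇ toℕ j) ∧ adj G i j then 1 else 0) (allFin n)) (allFin n))

CycAdj : ∀ {k} → Fin k → Fin k → Set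
CycAdj {k} i j =
  (toℕ j ≡ suc (toℕ i)) ⊎ (toℕ i ≡ suc (toℕ j))
  ⊎ ((toℕ i ≡ 0 × suc (toℕ j) ≡ k) ⊎ (toℕ j ≡ 0 × suc (toℕ i) ≡ k))

TwoCycAdj : ∀ {k} → Fin k ⊎ Fin k → Fin k ⊎ Fin k → Set
TwoCycAdj (inj₁ i) (inj₁ j) = CycAdj i j
TwoCycAdj (inj₂ i) (inj₂ j) = CycAdj i j
TwoCycAdj _ _ = Data.Empty.⊥
  where import Data.Empty

Contains2C : ∀ {n} → ℕ → Graph n → Set
Contains2C {n} k G =
  Σ (Fin k ⊎ Fin k → Fin n) λ f →
    Injective _≡_ _≡_ f ×
    (∀ u v → TwoCycAdj u v → adj G (f u) (f v) ≡ true)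

-- Planarity, via straight-line embeddings in the integer grid
-- (equivalent to topological planarity by Fáry's theorem plus
-- perturbation/scaling of coordinates).

Point : Set
Point = ℤ × ℤ

orient : Point → Point → Point → ℤ
orient (ax , ay) (bx , by) (cx , cy) =
  ((bx - ax) * (cy - ay)) - ((by - ay) * (cx - ax))

OnSeg : Point → Point → Point → Set
OnSeg a@(ax , ay) b@(bx , by) v@(vx , vy) =
  (orient a b v ≡ 0ℤ) ×
  ((((vx - ax) * (vx - bx)) ℤ.+ ((vy - ay) * (vy - by))) ≤ 0ℤ)

Cross : Point → Point → Point → Point → Set
Cross a b c d =
  ((orient a b c * orient a b d) < 0ℤ) × ((orient c d a * orient c d b) < 0ℤ)

record StraightLineEmbedding {n} (G : Graph n) : Set where
  field
    pos      : Fin n → Point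
    pos-inj  : Injective _≡_ _≡_ pos
    noTouch  : ∀ a b v → adj G a b ≡ true → v ≢ a → v ≢ b →
               ¬ OnSeg (pos a) (pos b) (pos v)
    noCross  : ∀ a b c d → adj G a b ≡ true → adj G c d ≡ true →
               a ≢ c → a ≢ d → b ≢ c → b ≢ d →
               ¬ Cross (pos a) (pos b) (pos c) (pos d)

Planar : ∀ {n} → Graph n → Set
Planar G = StraightLineEmbedding G

-- ex_P(n , 2C_k) ≥ m  (ex_P is a maximum over a finite nonempty family,
-- so this holds iff some 2C_k-free planar graph on n vertices has ≥ m edges).
ExPAtLeast : (n k : ℕ) → (ℕ → Set) → Set
ExPAtLeast n k P =
  ∃ λ (G : Graph n) → Planar G × ¬ Contains2C k G × P (edgeCount G)

-- remainder of m modulo d (d > 0 in all uses)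
rem : ℕ → ℕ → ℕ
rem m zero    = m
rem m (suc d) = m % suc d

-- Let d = k − 2. Take two apexes, adjacent to each other and to every other vertex, a hub,
-- and path vertices 0, 1, …, n − 4 cut into consecutive blocks of d, each block inducing a
-- path; the hub joins the last vertex of block 0 to the first vertex of block 1. Deleting the
-- apexes and the hub leaves paths on at most d vertices, while a k-cycle minus one vertex is
-- a path on d + 1 vertices; so every k-cycle passes through two of these three vertices, and
-- two disjoint k-cycles would need four. With the apexes at (0, ±1) and the other vertices on
-- the positive x-axis, in path order with the hub between blocks 0 and 1, the drawing is a
-- straight-line embedding. With m = n − 4 there are (n − 1) + (n − 2) + 2 + (m − ⌊m/d⌋)
-- edges, which is exactly the claimed bound.
module Submission where

open import Defs
open import Data.Nat using (ℕ; _≤_; _∸_; _*_; _+_)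
open import Data.Integer as ℤ using (ℤ; +_)

open import Data.Nat as ℕ using (zero; suc; pred; _<_; z≤n; s≤s; z<s; _<ᵇ_; _<?_; NonZero)
import Data.Nat.Properties as ℕP
open import Data.Nat.DivMod
  using (_/_; _%_; _mod_; /-monoˡ-≤; +-distrib-/-∣ʳ; n/n≡1; 0/n≡0; m<n⇒m/n≡0;
         m≡m%n+[m/n]*n; [m+kn]%n≡m%n; m<n⇒m%n≡m; n%n≡0; m%n<n)
open import Data.Nat.Divisibility using (∣-refl)
open import Data.Nat.ListAction using (sum)
open import Data.Nat.ListAction.Properties using (sum-++)
import Data.Nat.Tactic.RingSolver as ℕ-Ring
open import Data.Integer using (+[1+_]; -[1+_]; 0ℤ; 1ℤ; -1ℤ; +≤+; +<+)
import Data.Integer.Properties as ℤP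
import Data.Integer.Tactic.RingSolver as ℤ-Ring
open import Data.Bool using (Bool; true; if_then_else_; _∧_)
open import Data.Bool.Properties using (∨-comm)
open import Data.Fin as Fin using (Fin; toℕ; fromℕ; fromℕ<; inject₁; punchIn)
open import Data.Fin.Properties as FinP
  using (toℕ-injective; toℕ-inject₁; toℕ-fromℕ; toℕ-fromℕ<; ≤fromℕ; <-cmp; <⇒≢;
         any?; all?; punchIn-injective; punchInᵢ≢i; <⇒notInjective; fromℕ<-injective)
open import Data.Fin.Induction using (<-weakInduction; >-weakInduction)
open import Data.List using (List; []; _∷_; _∷ʳ_; map; allFin; concatMap; applyUpTo; tabulate)
open import Data.List.Properties using (map-tabulate; map-cong; applyUpTo-∷ʳ)
open import Data.Product using (_×_; _,_; ∃; proj₂)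
open import Data.Sum using (_⊎_; inj₁; inj₂; [_,_]′; swap)
open import Data.Sum.Properties using (inj₁-injective; inj₂-injective)
open import Data.Empty using (⊥; ⊥-elim)
open import Function using (_∘_)
open import Function.Bundles using (mk⇔)
open import Function.Definitions using (Injective)
open import Relation.Binary.Definitions using (tri<; tri≈; tri>)
open import Relation.Binary.PropositionalEquality
  using (_≡_; _≢_; refl; cong; cong₂; trans; subst; subst₂; module ≡-Reasoning)
  renaming (sym to ≡-sym)
open import Relation.Nullary using (¬_; Dec; yes; no; does; ¬?)
open import Relation.Nullary.Decidable
  using (_×-dec_; _⊎-dec_; _→-dec_; map′; dec-true; dec-false; does-⇔; from-yes)
open import Relation.Unary using (Decidable)

𝟙 : Bool → ℕ
𝟙 b = if b then 1 else 0

∑ : ℕ → (ℕ → ℕ) → ℕ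
∑ n f = sum (applyUpTo f n)

∑-suc : ∀ n f → ∑ (suc n) f ≡ ∑ n f + f n
∑-suc n f = begin
  sum (applyUpTo f (suc n))        ≡⟨ cong sum (applyUpTo-∷ʳ f n) ⟨
  sum (applyUpTo f n ∷ʳ f n)       ≡⟨ sum-++ (applyUpTo f n) (f n ∷ []) ⟩
  ∑ n f + (f n + 0)                ≡⟨ cong (λ x → ∑ n f + x) (ℕP.+-identityʳ (f n)) ⟩
  ∑ n f + f n                      ∎
  where open ≡-Reasoning

∑≤∑-suc : ∀ n f → ∑ n f ≤ ∑ (suc n) f
∑≤∑-suc n f = subst (∑ n f ≤_) (≡-sym (∑-suc n f)) (ℕP.m≤m+n (∑ n f) (f n))

∑-mono-≤ : ∀ n {f g} → (∀ {i} → i < n → f i ≤ g i) → ∑ n f ≤ ∑ n g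
∑-mono-≤ zero    f≤g = z≤n
∑-mono-≤ (suc n) f≤g = ℕP.+-mono-≤ (f≤g z<s) (∑-mono-≤ n (f≤g ∘ s≤s))

∑-ones : ∀ n → ∑ n (λ _ → 1) ≡ n
∑-ones zero    = refl
∑-ones (suc n) = cong suc (∑-ones n)

term≤∑ : ∀ n f {a} → a < n → f a ≤ ∑ n f
term≤∑ (suc n) f {zero}  _         = ℕP.m≤m+n (f 0) _
term≤∑ (suc n) f {suc a} (s≤s a<n) =
  ℕP.≤-trans (term≤∑ n (f ∘ suc) a<n) (ℕP.m≤n+m _ (f 0))

two-terms≤∑ : ∀ n f {a b} → a < b → b < n → f a + f b ≤ ∑ n f
two-terms≤∑ (suc n) f {zero}  {suc b} _         (s≤s b<n) =
  ℕP.+-monoʳ-≤ (f 0) (term≤∑ n (f ∘ suc) b<n)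
two-terms≤∑ (suc n) f {suc a} {suc b} (s≤s a<b) (s≤s b<n) =
  ℕP.≤-trans (two-terms≤∑ n (f ∘ suc) a<b b<n) (ℕP.m≤n+m _ (f 0))

sum-allFin : ∀ n (f : ℕ → ℕ) → sum (map (f ∘ toℕ) (allFin n)) ≡ ∑ n f
sum-allFin n f =
  cong sum (trans (map-tabulate {n = n} (λ i → i) (f ∘ toℕ)) (tabulate-toℕ n f))
  where
    tabulate-toℕ : ∀ n (f : ℕ → ℕ) → tabulate {n = n} (f ∘ toℕ) ≡ applyUpTo f n
    tabulate-toℕ zero    f = refl
    tabulate-toℕ (suc n) f = cong (f 0 ∷_) (tabulate-toℕ n (f ∘ suc))

sum-concatMap : ∀ {A : Set} (g : A → List ℕ) xs →
                sum (concatMap g xs) ≡ sum (map (sum ∘ g) xs)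
sum-concatMap g []       = refl
sum-concatMap g (x ∷ xs) =
  trans (sum-++ (g x) _) (cong (λ s → sum (g x) + s) (sum-concatMap g xs))

double-sum-allFin : ∀ n (F : ℕ → ℕ → ℕ) →
  sum (concatMap (λ i → map (λ j → F (toℕ i) (toℕ j)) (allFin n)) (allFin n))
    ≡ ∑ n (λ i → ∑ n (F i))
double-sum-allFin n F = begin
  sum (concatMap (λ i → map (F (toℕ i) ∘ toℕ) (allFin n)) (allFin n))
    ≡⟨ sum-concatMap _ (allFin n) ⟩
  sum (map (λ i → sum (map (F (toℕ i) ∘ toℕ) (allFin n))) (allFin n))
    ≡⟨ cong sum (map-cong (λ i → sum-allFin n (F (toℕ i))) (allFin n)) ⟩
  sum (map (λ i → ∑ n (F (toℕ i))) (allFin n))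
    ≡⟨ sum-allFin n (λ i → ∑ n (F i)) ⟩
  ∑ n (λ i → ∑ n (F i)) ∎
  where open ≡-Reasoning

/-suc : ∀ m d .{{_ : NonZero d}} → suc m / d ≡ m / d ⊎ suc m / d ≡ suc (m / d)
/-suc m d with ℕP.m≤n⇒m<n∨m≡n upper
  where
    upper : suc m / d ≤ suc (m / d)
    upper = begin
      suc m / d       ≡⟨ cong (_/ d) (ℕP.+-comm 1 m) ⟩
      (m + 1) / d     ≤⟨ /-monoˡ-≤ d (ℕP.+-monoʳ-≤ m (ℕ.>-nonZero⁻¹ d)) ⟩
      (m + d) / d     ≡⟨ +-distrib-/-∣ʳ m ∣-refl ⟩
      m / d + d / d   ≡⟨ cong (λ x → m / d + x) (n/n≡1 d) ⟩
      m / d + 1       ≡⟨ ℕP.+-comm (m / d) 1 ⟩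
      suc (m / d)     ∎
      where open ℕP.≤-Reasoning
... | inj₁ below = inj₁ (ℕP.≤-antisym (ℕP.≤-pred below) (/-monoˡ-≤ d (ℕP.n≤1+n m)))
... | inj₂ next  = inj₂ next

/-%-injective : ∀ {m n} d .{{_ : NonZero d}} → m / d ≡ n / d → m % d ≡ n % d → m ≡ n
/-%-injective {m} {n} d div≡ mod≡ = begin
  m                   ≡⟨ m≡m%n+[m/n]*n m d ⟩
  m % d + m / d * d   ≡⟨ cong₂ (λ r q → r + q * d) mod≡ div≡ ⟩
  n % d + n / d * d   ≡⟨ m≡m%n+[m/n]*n n d ⟨
  n                   ∎
  where open ≡-Reasoning

suc-% : ∀ m d .{{_ : NonZero d}} → suc m % d ≡ suc (m % d) % d
suc-% m d = trans (cong (λ x → suc x % d) (m≡m%n+[m/n]*n m d))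
                  ([m+kn]%n≡m%n (suc (m % d)) (m / d) d)

-- The correction d · (1 ∸ r) in the bound turns r = (m + 1) mod d back into (m mod d) + 1.
suc-%-unwrap : ∀ m d .{{_ : NonZero d}} → suc m % d + d * (1 ∸ suc m % d) ≡ suc (m % d)
suc-%-unwrap m d with ℕP.m≤n⇒m<n∨m≡n (m%n<n m d)
... | inj₁ no-wrap = begin
  suc m % d + d * (1 ∸ suc m % d)
    ≡⟨ cong (λ r → r + d * (1 ∸ r)) (trans (suc-% m d) (m<n⇒m%n≡m no-wrap)) ⟩
  suc (m % d) + d * (0 ∸ m % d)   ≡⟨ cong (λ x → suc (m % d) + d * x) (ℕP.0∸n≡0 (m % d)) ⟩
  suc (m % d) + d * 0             ≡⟨ cong (λ x → suc (m % d) + x) (ℕP.*-zeroʳ d) ⟩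
  suc (m % d) + 0                 ≡⟨ ℕP.+-identityʳ _ ⟩
  suc (m % d)                     ∎
  where open ≡-Reasoning
... | inj₂ wrap = begin
  suc m % d + d * (1 ∸ suc m % d)
    ≡⟨ cong (λ r → r + d * (1 ∸ r))
            (trans (suc-% m d) (trans (cong (_% d) wrap) (n%n≡0 d))) ⟩
  d * 1                           ≡⟨ ℕP.*-identityʳ d ⟩
  d                               ≡⟨ wrap ⟨
  suc (m % d)                     ∎
  where open ≡-Reasoning

true⇒witness : ∀ {A : Set} (a? : Dec A) → does a? ≡ true → A
true⇒witness (yes a) _  = a
true⇒witness (no _)  ()

-- Cycles through few special vertices

module _ {A : Set} {k} (c : Fin (suc k) → A) (p : Fin (suc k))
         (step : ∀ i j → CycAdj i j → i ≢ p → j ≢ p → c i ≡ c j) where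

  private
    last : Fin (suc k)
    last = fromℕ k

    step-suc : ∀ i → inject₁ i ≢ p → Fin.suc i ≢ p → c (inject₁ i) ≡ c (Fin.suc i)
    step-suc i = step (inject₁ i) (Fin.suc i) (inj₁ (cong suc (≡-sym (toℕ-inject₁ i))))

    below : ∀ i → i Fin.< p → c Fin.zero ≡ c i
    below = <-weakInduction (λ i → i Fin.< p → c Fin.zero ≡ c i) (λ _ → refl)
      λ i ih i+1<p →
        let i<p = ℕP.<-trans (subst (_< suc (toℕ i)) (≡-sym (toℕ-inject₁ i)) (ℕP.n<1+n _)) i+1<p
        in trans (ih i<p) (step-suc i (<⇒≢ i<p) (<⇒≢ i+1<p))

    above : ∀ i → p Fin.< i → c i ≡ c last
    above = >-weakInduction (λ i → p Fin.< i → c i ≡ c last) (λ _ → refl)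
      λ i ih p<i →
        let p<i+1 = ℕP.<-trans (subst (toℕ p <_) (toℕ-inject₁ i) p<i) (ℕP.n<1+n _)
        in trans (step-suc i (<⇒≢ p<i ∘ ≡-sym) (<⇒≢ p<i+1 ∘ ≡-sym)) (ih p<i+1)

  cycle-minus-constant : ∀ i j → i ≢ p → j ≢ p → c i ≡ c j
  cycle-minus-constant i j i≢p j≢p with p FinP.≟ Fin.zero
  ... | yes p≡0 = trans (above i (beyond i≢p)) (≡-sym (above j (beyond j≢p)))
    where
      beyond : ∀ {i} → i ≢ p → p Fin.< i
      beyond {Fin.zero}  i≢p = ⊥-elim (i≢p (≡-sym p≡0))
      beyond {Fin.suc i} _   = subst (Fin._< Fin.suc i) (≡-sym p≡0) z<s
  ... | no p≢0 = trans (≡-sym (from-zero i i≢p)) (from-zero j j≢p)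
    where
      from-zero : ∀ i → i ≢ p → c Fin.zero ≡ c i
      from-zero i i≢p with <-cmp i p
      ... | tri< i<p _ _ = below i i<p
      ... | tri≈ _ i≡p _ = ⊥-elim (i≢p i≡p)
      ... | tri> _ _ p<i = trans wrap (≡-sym (above i p<i))
        where
          wrap : c Fin.zero ≡ c last
          wrap = step Fin.zero last (inj₂ (inj₂ (inj₁ (refl , cong suc (toℕ-fromℕ k)))))
                   (p≢0 ∘ ≡-sym) (<⇒≢ (ℕP.<-≤-trans p<i (≤fromℕ i)) ∘ ≡-sym)

IsCycle : ∀ {n k} → Graph n → (Fin k → Fin n) → Set
IsCycle G g = Injective _≡_ _≡_ g × (∀ i j → CycAdj i j → adj G (g i) (g j) ≡ true)

-- Certifies that every component of G − S has at most d vertices.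
record BlockDecomposition {n} (G : Graph n) (S : Fin n → Set) (d : ℕ) : Set where
  field
    block           : Fin n → ℕ
    slot            : Fin n → Fin d
    block-edge      : ∀ {u v} → ¬ S u → ¬ S v → adj G u v ≡ true → block u ≡ block v
    label-injective : ∀ {u v} → ¬ S u → ¬ S v → block u ≡ block v → slot u ≡ slot v → u ≡ v

module _ {n d} {G : Graph n} {S : Fin n → Set} (S? : Decidable S)
         (B : BlockDecomposition G S d) where
  open BlockDecomposition B

  cycle-meets-twice : (g : Fin (2 + d) → Fin n) → IsCycle G g →
                      ∀ p → ∃ λ j → j ≢ p × S (g j)
  cycle-meets-twice g (g-inj , g-adj) p with any? (λ j → ¬? (j FinP.≟ p) ×-dec S? (g j))
  ... | yes found = found
  ... | no none   = ⊥-elim (<⇒notInjective (ℕP.n<1+n d) slot-injective)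
    where
      outside : ∀ {j} → j ≢ p → ¬ S (g j)
      outside j≢p s = none (_ , j≢p , s)

      same-block : ∀ i j → i ≢ p → j ≢ p → block (g i) ≡ block (g j)
      same-block = cycle-minus-constant (block ∘ g) p λ i j i~j i≢p j≢p →
        block-edge (outside i≢p) (outside j≢p) (g-adj i j i~j)

      slot-injective : Injective _≡_ _≡_ (slot ∘ g ∘ punchIn p)
      slot-injective {x} {y} eq = punchIn-injective p x y (g-inj (label-injective
        (outside (punchInᵢ≢i p x)) (outside (punchInᵢ≢i p y))
        (same-block _ _ (punchInᵢ≢i p x) (punchInᵢ≢i p y)) eq))

third-element-unique : ∀ (a b x y : Fin 3) → a ≢ b → x ≢ a → x ≢ b → y ≢ a → y ≢ b → x ≡ y
third-element-unique = from-yes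
  (all? λ (a : Fin 3) → all? λ (b : Fin 3) → all? λ (x : Fin 3) → all? λ (y : Fin 3) →
    ¬? (a FinP.≟ b) →-dec ¬? (x FinP.≟ a) →-dec ¬? (x FinP.≟ b) →-dec
    ¬? (y FinP.≟ a) →-dec ¬? (y FinP.≟ b) →-dec x FinP.≟ y)

module _ {n k} {G : Graph n}
         (meets-twice : ∀ (g : Fin (suc k) → Fin n) → IsCycle G g →
                        ∀ p → ∃ λ j → j ≢ p × toℕ (g j) < 3)
         where

  private
    TwoSpecial : (Fin (suc k) → Fin n) → Set
    TwoSpecial g = ∃ λ i → ∃ λ j → j ≢ i × toℕ (g i) < 3 × toℕ (g j) < 3

    two-special : ∀ g → IsCycle G g → TwoSpecial g
    two-special g cycle
      with i , _ , gi<3 ← meets-twice g cycle Fin.zero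
      with j , j≢i , gj<3 ← meets-twice g cycle i
      = i , j , j≢i , gi<3 , gj<3

  meets-twice⇒¬Contains2C : ¬ Contains2C (suc k) G
  meets-twice⇒¬Contains2C (f , f-inj , f-adj) =
    four-special (two-special (f ∘ inj₁) cycle₁) (two-special (f ∘ inj₂) cycle₂)
    where
      cycle₁ : IsCycle G (f ∘ inj₁)
      cycle₁ = inj₁-injective ∘ f-inj , λ i j → f-adj (inj₁ i) (inj₁ j)

      cycle₂ : IsCycle G (f ∘ inj₂)
      cycle₂ = inj₂-injective ∘ f-inj , λ i j → f-adj (inj₂ i) (inj₂ j)

      apart : ∀ {u w} (fu<3 : toℕ (f u) < 3) (fw<3 : toℕ (f w) < 3) → u ≢ w →
              fromℕ< fu<3 ≢ fromℕ< fw<3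
      apart fu<3 fw<3 u≢w eq = u≢w (f-inj (toℕ-injective (fromℕ<-injective _ _ fu<3 fw<3 eq)))

      four-special : TwoSpecial (f ∘ inj₁) → TwoSpecial (f ∘ inj₂) → ⊥
      four-special (a , a′ , a′≢a , fa<3 , fa′<3) (b , b′ , b′≢b , fb<3 , fb′<3) =
        apart fb<3 fb′<3 (b′≢b ∘ ≡-sym ∘ inj₂-injective) (third-element-unique _ _ _ _
          (apart fa<3 fa′<3 (a′≢a ∘ ≡-sym ∘ inj₁-injective))
          (apart fb<3 fa<3 λ ()) (apart fb<3 fa′<3 λ ())
          (apart fb′<3 fa<3 λ ()) (apart fb′<3 fa′<3 λ ()))

-- Straight-line drawings on two apexes and a ray

data Site : Set where
  top bottom : Site
  axis       : ℕ → Site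

axis-injective : ∀ {a b} → axis a ≡ axis b → a ≡ b
axis-injective refl = refl

point : Site → Point
point top      = 0ℤ , 1ℤ
point bottom   = 0ℤ , -1ℤ
point (axis a) = +[1+ a ] , 0ℤ

point-injective : Injective _≡_ _≡_ point
point-injective {top}    {top}    _    = refl
point-injective {bottom} {bottom} _    = refl
point-injective {axis _} {axis _} refl = refl
point-injective {top}    {bottom} ()
point-injective {top}    {axis _} ()
point-injective {bottom} {top}    ()
point-injective {bottom} {axis _} ()
point-injective {axis _} {top}    ()
point-injective {axis _} {bottom} ()

data FanEdge : Site → Site → Set where
  top-bottom  : FanEdge top bottom
  top-axis    : ∀ a → FanEdge top (axis a)
  bottom-axis : ∀ a → FanEdge bottom (axis a)
  axis-step   : ∀ a → FanEdge (axis a) (axis (suc a))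

orient-unfold : ∀ ax ay bx by cx cy → orient (ax , ay) (bx , by) (cx , cy)
  ≡ (bx ℤ.- ax) ℤ.* (cy ℤ.- ay) ℤ.- (by ℤ.- ay) ℤ.* (cx ℤ.- ax)
orient-unfold _ _ _ _ _ _ = refl

orient-swap : ∀ p q r → orient q p r ≡ ℤ.- orient p q r
orient-swap (ax , ay) (bx , by) (cx , cy) = formula ax ay bx by cx cy
  where
    formula : ∀ ax ay bx by cx cy →
      (ax ℤ.- bx) ℤ.* (cy ℤ.- by) ℤ.- (ay ℤ.- by) ℤ.* (cx ℤ.- bx)
        ≡ ℤ.- ((bx ℤ.- ax) ℤ.* (cy ℤ.- ay) ℤ.- (by ℤ.- ay) ℤ.* (cx ℤ.- ax))
    formula = ℤ-Ring.solve-∀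

orient-top-bottom : ∀ x → orient (point top) (point bottom) (x , 0ℤ) ≡ x ℤ.+ x
orient-top-bottom x = trans (orient-unfold 0ℤ 1ℤ 0ℤ -1ℤ x 0ℤ) (ℤ-Ring.solve (x ∷ []))

orient-top-axis-bottom : ∀ x → orient (point top) (x , 0ℤ) (point bottom) ≡ ℤ.- (x ℤ.+ x)
orient-top-axis-bottom x =
  trans (orient-unfold 0ℤ 1ℤ x 0ℤ 0ℤ -1ℤ) (ℤ-Ring.solve (x ∷ []))

orient-bottom-axis-top : ∀ x → orient (point bottom) (x , 0ℤ) (point top) ≡ x ℤ.+ x
orient-bottom-axis-top x =
  trans (orient-unfold 0ℤ -1ℤ x 0ℤ 0ℤ 1ℤ) (ℤ-Ring.solve (x ∷ []))

orient-top-axis-axis : ∀ x y → orient (point top) (x , 0ℤ) (y , 0ℤ) ≡ y ℤ.- x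
orient-top-axis-axis x y =
  trans (orient-unfold 0ℤ 1ℤ x 0ℤ y 0ℤ) (ℤ-Ring.solve (x ∷ y ∷ []))

orient-bottom-axis-axis : ∀ x y → orient (point bottom) (x , 0ℤ) (y , 0ℤ) ≡ x ℤ.- y
orient-bottom-axis-axis x y =
  trans (orient-unfold 0ℤ -1ℤ x 0ℤ y 0ℤ) (ℤ-Ring.solve (x ∷ y ∷ []))

orient-axis-axis : ∀ x y z w → orient (x , 0ℤ) (y , 0ℤ) (z , w) ≡ (y ℤ.- x) ℤ.* w
orient-axis-axis x y z w =
  trans (orient-unfold x 0ℤ y 0ℤ z w) (ℤ-Ring.solve (x ∷ y ∷ z ∷ w ∷ []))

axis-suc : ∀ a → point (axis (suc a)) ≡ (+[1+ a ] ℤ.+ 1ℤ , 0ℤ)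
axis-suc a = cong (λ m → + m , 0ℤ) (ℕP.+-comm 1 (suc a))

orient-step : ∀ a (p : Point) → orient (point (axis a)) (point (axis (suc a))) p ≡ proj₂ p
orient-step a (x , y) = trans (cong (λ q → orient (point (axis a)) q (x , y)) (axis-suc a))
  (trans (orient-axis-axis +[1+ a ] (+[1+ a ] ℤ.+ 1ℤ) x y) (unit-width +[1+ a ] y))
  where
    unit-width : ∀ x y → ((x ℤ.+ 1ℤ) ℤ.- x) ℤ.* y ≡ y
    unit-width = ℤ-Ring.solve-∀

x[x-1]-positive : ∀ x → x ≢ 0ℤ → x ≢ 1ℤ → 0ℤ ℤ.< x ℤ.* (x ℤ.- 1ℤ)
x[x-1]-positive (+ 0)        x≢0 _   = ⊥-elim (x≢0 refl)
x[x-1]-positive (+ 1)        _   x≢1 = ⊥-elim (x≢1 refl)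
x[x-1]-positive +[1+ suc _ ] _   _   = +<+ z<s
x[x-1]-positive -[1+ _ ]     _   _   = +<+ z<s

axis-separated : ∀ {a c} → axis c ≢ axis a → +[1+ c ] ℤ.- +[1+ a ] ≢ 0ℤ
axis-separated c≢a eq = c≢a (point-injective (cong (_, 0ℤ) (ℤP.i-j≡0⇒i≡j _ _ eq)))

Cross-swap : ∀ p q r s → Cross p q r s → Cross r s p q
Cross-swap _ _ _ _ (c₁ , c₂) = c₂ , c₁

Cross-flipˡ : ∀ p q r s → Cross p q r s → Cross q p r s
Cross-flipˡ p q r s (c₁ , c₂) =
  subst (ℤ._< 0ℤ) (≡-sym first) c₁ ,
  subst (ℤ._< 0ℤ) (ℤP.*-comm (orient r s p) (orient r s q)) c₂
  where
    neg*neg : ∀ x y → (ℤ.- x) ℤ.* (ℤ.- y) ≡ x ℤ.* y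
    neg*neg = ℤ-Ring.solve-∀
    first : orient q p r ℤ.* orient q p s ≡ orient p q r ℤ.* orient p q s
    first = trans (cong₂ ℤ._*_ (orient-swap p q r) (orient-swap p q s))
                  (neg*neg (orient p q r) (orient p q s))

Cross-flipʳ : ∀ p q r s → Cross p q r s → Cross p q s r
Cross-flipʳ p q r s = Cross-swap s r p q ∘ Cross-flipˡ r s p q ∘ Cross-swap p q r s

OnSeg-sym : ∀ p q v → OnSeg p q v → OnSeg q p v
OnSeg-sym p@(ax , ay) q@(bx , by) v@(vx , vy) (o , dot) =
  trans (orient-swap p q v) (cong ℤ.-_ o) ,
  subst (ℤ._≤ 0ℤ)
        (cong₂ ℤ._+_ (ℤP.*-comm (vx ℤ.- ax) (vx ℤ.- bx)) (ℤP.*-comm (vy ℤ.- ay) (vy ℤ.- by)))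
        dot

nonneg-¬Cross : ∀ p q r s → 0ℤ ℤ.≤ orient p q r ℤ.* orient p q s → ¬ Cross p q r s
nonneg-¬Cross _ _ _ _ 0≤c₁ (c₁<0 , _) = ℤP.<-irrefl refl (ℤP.≤-<-trans 0≤c₁ c₁<0)

collinear-¬Cross : ∀ p q r s → orient p q s ≡ 0ℤ → ¬ Cross p q r s
collinear-¬Cross p q r s pqs≡0 = nonneg-¬Cross p q r s
  (ℤP.≤-reflexive (≡-sym (trans (cong (orient p q r ℤ.*_) pqs≡0) (ℤP.*-zeroʳ (orient p q r)))))

certificate-¬Cross : ∀ p q r s α β .{{_ : ℤ.Positive α}} .{{_ : ℤ.Positive β}} →
  α ℤ.* (orient p q r ℤ.* orient p q s) ℤ.+ β ℤ.* (orient r s p ℤ.* orient r s q) ≡ 0ℤ →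
  ¬ Cross p q r s
certificate-¬Cross _ _ _ _ α β eq (c₁<0 , c₂<0) =
  ℤP.<-irrefl eq (ℤP.+-mono-< (scaled α c₁<0) (scaled β c₂<0))
  where
    scaled : ∀ γ .{{_ : ℤ.Positive γ}} {c} → c ℤ.< 0ℤ → γ ℤ.* c ℤ.< 0ℤ
    scaled γ c<0 = subst (γ ℤ.* _ ℤ.<_) (ℤP.*-zeroʳ γ) (ℤP.*-monoˡ-<-pos γ c<0)

apexes-¬Cross : ∀ b c → ¬ Cross (point top) (point bottom) (point (axis b)) (point (axis c))
apexes-¬Cross b c = nonneg-¬Cross (point top) (point bottom) (point (axis b)) (point (axis c))
  (subst (0ℤ ℤ.≤_) (≡-sym (cong₂ ℤ._*_ (orient-top-bottom +[1+ b ]) (orient-top-bottom +[1+ c ])))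
    (+≤+ z≤n))

spokes-¬Cross : ∀ a b → ¬ Cross (point top) (point (axis a)) (point bottom) (point (axis b))
spokes-¬Cross a b = certificate-¬Cross (point top) A (point bottom) B +[1+ b ] +[1+ a ] (begin
  +[1+ b ] ℤ.* (orient (point top) A (point bottom) ℤ.* orient (point top) A B)
    ℤ.+ +[1+ a ] ℤ.* (orient (point bottom) B (point top) ℤ.* orient (point bottom) B A)
    ≡⟨ cong₂ (λ u v → +[1+ b ] ℤ.* u ℤ.+ +[1+ a ] ℤ.* v)
         (cong₂ ℤ._*_ (orient-top-axis-bottom +[1+ a ]) (orient-top-axis-axis +[1+ a ] +[1+ b ]))
         (cong₂ ℤ._*_ (orient-bottom-axis-top +[1+ b ]) (orient-bottom-axis-axis +[1+ b ] +[1+ a ])) ⟩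
  +[1+ b ] ℤ.* (ℤ.- (+[1+ a ] ℤ.+ +[1+ a ]) ℤ.* (+[1+ b ] ℤ.- +[1+ a ]))
    ℤ.+ +[1+ a ] ℤ.* ((+[1+ b ] ℤ.+ +[1+ b ]) ℤ.* (+[1+ b ] ℤ.- +[1+ a ]))
    ≡⟨ balance +[1+ a ] +[1+ b ] ⟩
  0ℤ ∎)
  where
    open ≡-Reasoning
    A = point (axis a)
    B = point (axis b)
    balance : ∀ x y →
      y ℤ.* (ℤ.- (x ℤ.+ x) ℤ.* (y ℤ.- x)) ℤ.+ x ℤ.* ((y ℤ.+ y) ℤ.* (y ℤ.- x)) ≡ 0ℤ
    balance = ℤ-Ring.solve-∀

step-¬OnSeg : ∀ a c → axis c ≢ axis a → axis c ≢ axis (suc a) →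
              ¬ OnSeg (point (axis a)) (point (axis (suc a))) (point (axis c))
step-¬OnSeg a c c≢a c≢a+1 on = ℤP.<-irrefl refl (ℤP.<-≤-trans
  (x[x-1]-positive x (axis-separated c≢a) x≢1)
  (subst (ℤ._≤ 0ℤ) (dot-formula +[1+ a ] +[1+ c ])
    (proj₂ (subst (λ q → OnSeg (point (axis a)) q (point (axis c))) (axis-suc a) on))))
  where
    x = +[1+ c ] ℤ.- +[1+ a ]
    dot-formula : ∀ a c → (c ℤ.- a) ℤ.* (c ℤ.- (a ℤ.+ 1ℤ)) ℤ.+ (0ℤ ℤ.- 0ℤ) ℤ.* (0ℤ ℤ.- 0ℤ)
                          ≡ (c ℤ.- a) ℤ.* ((c ℤ.- a) ℤ.- 1ℤ)
    dot-formula = ℤ-Ring.solve-∀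
    shift : ∀ a c → c ℤ.- (a ℤ.+ 1ℤ) ≡ (c ℤ.- a) ℤ.- 1ℤ
    shift = ℤ-Ring.solve-∀
    x≢1 : x ≢ 1ℤ
    x≢1 x≡1 = c≢a+1 (point-injective (trans (cong (_, 0ℤ) (ℤP.i-j≡0⇒i≡j _ _
      (trans (shift +[1+ a ] +[1+ c ]) (cong (ℤ._- 1ℤ) x≡1)))) (≡-sym (axis-suc a))))

fan-¬OnSeg : ∀ {s t} v → FanEdge s t → v ≢ s → v ≢ t → ¬ OnSeg (point s) (point t) (point v)
fan-¬OnSeg top      top-bottom      v≢s _   = ⊥-elim (v≢s refl)
fan-¬OnSeg bottom   top-bottom      _   v≢t = ⊥-elim (v≢t refl)
fan-¬OnSeg (axis c) top-bottom      _   _   (o , _)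
  with () ← trans (≡-sym (orient-top-bottom +[1+ c ])) o
fan-¬OnSeg top      (top-axis _)    v≢s _   = ⊥-elim (v≢s refl)
fan-¬OnSeg bottom   (top-axis a)    _   _   (o , _)
  with () ← trans (≡-sym (orient-top-axis-bottom +[1+ a ])) o
fan-¬OnSeg (axis c) (top-axis a)    _   v≢t (o , _) =
  axis-separated v≢t (trans (≡-sym (orient-top-axis-axis +[1+ a ] +[1+ c ])) o)
fan-¬OnSeg top      (bottom-axis a) _   _   (o , _)
  with () ← trans (≡-sym (orient-bottom-axis-top +[1+ a ])) o
fan-¬OnSeg bottom   (bottom-axis _) v≢s _   = ⊥-elim (v≢s refl)
fan-¬OnSeg (axis c) (bottom-axis a) _   v≢t (o , _) =
  axis-separated (v≢t ∘ ≡-sym) (trans (≡-sym (orient-bottom-axis-axis +[1+ a ] +[1+ c ])) o)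
fan-¬OnSeg top      (axis-step a)   _   _   (o , _)
  with () ← trans (≡-sym (orient-step a (point top))) o
fan-¬OnSeg bottom   (axis-step a)   _   _   (o , _)
  with () ← trans (≡-sym (orient-step a (point bottom))) o
fan-¬OnSeg (axis c) (axis-step a)   v≢s v≢t = step-¬OnSeg a c v≢s v≢t

fan-¬Cross : ∀ {s t u v} → FanEdge s t → FanEdge u v → s ≢ u → s ≢ v → t ≢ u → t ≢ v →
             ¬ Cross (point s) (point t) (point u) (point v)
fan-¬Cross top-bottom      top-bottom      s≢u _   _   _ = ⊥-elim (s≢u refl)
fan-¬Cross top-bottom      (top-axis _)    s≢u _   _   _ = ⊥-elim (s≢u refl)
fan-¬Cross top-bottom      (bottom-axis _) _   _   t≢u _ = ⊥-elim (t≢u refl)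
fan-¬Cross top-bottom      (axis-step b)   _   _   _   _ = apexes-¬Cross b (suc b)
fan-¬Cross (top-axis _)    top-bottom      s≢u _   _   _ = ⊥-elim (s≢u refl)
fan-¬Cross (top-axis _)    (top-axis _)    s≢u _   _   _ = ⊥-elim (s≢u refl)
fan-¬Cross (top-axis a)    (bottom-axis b) _   _   _   _ = spokes-¬Cross a b
fan-¬Cross (top-axis a)    (axis-step b)   _   _   _   _ =
  collinear-¬Cross (point (axis b)) (point (axis (suc b))) (point top) (point (axis a))
    (orient-step b (point (axis a)))
  ∘ Cross-swap (point top) (point (axis a)) (point (axis b)) (point (axis (suc b)))
fan-¬Cross (bottom-axis _) top-bottom      _   s≢v _   _ = ⊥-elim (s≢v refl)
fan-¬Cross (bottom-axis a) (top-axis b)    _   _   _   _ =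
  spokes-¬Cross b a ∘ Cross-swap (point bottom) (point (axis a)) (point top) (point (axis b))
fan-¬Cross (bottom-axis _) (bottom-axis _) s≢u _   _   _ = ⊥-elim (s≢u refl)
fan-¬Cross (bottom-axis a) (axis-step b)   _   _   _   _ =
  collinear-¬Cross (point (axis b)) (point (axis (suc b))) (point bottom) (point (axis a))
    (orient-step b (point (axis a)))
  ∘ Cross-swap (point bottom) (point (axis a)) (point (axis b)) (point (axis (suc b)))
fan-¬Cross (axis-step a)   top-bottom      _   _   _   _ =
  apexes-¬Cross a (suc a)
  ∘ Cross-swap (point (axis a)) (point (axis (suc a))) (point top) (point bottom)
fan-¬Cross (axis-step a)   (top-axis b)    _   _   _   _ =
  collinear-¬Cross (point (axis a)) (point (axis (suc a))) (point top) (point (axis b))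
    (orient-step a (point (axis b)))
fan-¬Cross (axis-step a)   (bottom-axis b) _   _   _   _ =
  collinear-¬Cross (point (axis a)) (point (axis (suc a))) (point bottom) (point (axis b))
    (orient-step a (point (axis b)))
fan-¬Cross (axis-step a)   (axis-step b)   _   _   _   _ =
  collinear-¬Cross (point (axis a)) (point (axis (suc a))) (point (axis b)) (point (axis (suc b)))
    (orient-step a (point (axis (suc b))))

module _ {n} (G : Graph n) (site : Fin n → Site) (site-injective : Injective _≡_ _≡_ site)
         (fan : ∀ u v → adj G u v ≡ true → FanEdge (site u) (site v) ⊎ FanEdge (site v) (site u))
         where

  private
    apart : ∀ {u v} → u ≢ v → site u ≢ site v
    apart u≢v = u≢v ∘ site-injective

    ¬OnSeg : ∀ {s t} v → FanEdge s t ⊎ FanEdge t s → v ≢ s → v ≢ t →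
             ¬ OnSeg (point s) (point t) (point v)
    ¬OnSeg v (inj₁ e) v≢s v≢t = fan-¬OnSeg v e v≢s v≢t
    ¬OnSeg {s} {t} v (inj₂ e) v≢s v≢t =
      fan-¬OnSeg v e v≢t v≢s ∘ OnSeg-sym (point s) (point t) (point v)

    ¬Cross : ∀ {s t u v} → FanEdge s t ⊎ FanEdge t s → FanEdge u v ⊎ FanEdge v u →
             s ≢ u → s ≢ v → t ≢ u → t ≢ v → ¬ Cross (point s) (point t) (point u) (point v)
    ¬Cross (inj₁ e) (inj₁ e′) s≢u s≢v t≢u t≢v = fan-¬Cross e e′ s≢u s≢v t≢u t≢v
    ¬Cross {s} {t} {u} {v} (inj₁ e) (inj₂ e′) s≢u s≢v t≢u t≢v =
      fan-¬Cross e e′ s≢v s≢u t≢v t≢u ∘ Cross-flipʳ (point s) (point t) (point u) (point v)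
    ¬Cross {s} {t} {u} {v} (inj₂ e) (inj₁ e′) s≢u s≢v t≢u t≢v =
      fan-¬Cross e e′ t≢u t≢v s≢u s≢v ∘ Cross-flipˡ (point s) (point t) (point u) (point v)
    ¬Cross {s} {t} {u} {v} (inj₂ e) (inj₂ e′) s≢u s≢v t≢u t≢v =
      fan-¬Cross e e′ t≢v t≢u s≢v s≢u ∘ Cross-flipʳ (point t) (point s) (point u) (point v)
        ∘ Cross-flipˡ (point s) (point t) (point u) (point v)

  fan-planar : Planar G
  fan-planar = record
    { pos     = point ∘ site
    ; pos-inj = site-injective ∘ point-injective
    ; noTouch = λ a b v a~b v≢a v≢b → ¬OnSeg (site v) (fan a b a~b) (apart v≢a) (apart v≢b)
    ; noCross = λ a b c d a~b c~d a≢c a≢d b≢c b≢d →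
        ¬Cross (fan a b a~b) (fan c d c~d) (apart a≢c) (apart a≢d) (apart b≢c) (apart b≢d)
    }

-- Vertex 0 is the top apex, 1 the bottom apex, 2 the hub, and 3 + t the path vertex t, which
-- lies in block t / d. Each edge is listed once, from its smaller end.
module Construction (d : ℕ) .{{_ : NonZero d}} where

  data Link : ℕ → ℕ → Set where
    top-link    : ∀ j → Link 0 (suc j)
    bottom-link : ∀ j → Link 1 (2 + j)
    hub-left    : ∀ t → suc t ≡ d → Link 2 (3 + t)
    hub-right   : Link 2 (3 + d)
    path        : ∀ t → t / d ≡ suc t / d → Link (3 + t) (4 + t)

  link? : ∀ i j → Dec (Link i j)
  link? 0 0                   = no λ ()
  link? 0 (suc j)             = yes (top-link j)
  link? 1 0                   = no λ ()
  link? 1 1                   = no λ ()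
  link? 1 (suc (suc j))       = yes (bottom-link j)
  link? 2 0                   = no λ ()
  link? 2 1                   = no λ ()
  link? 2 2                   = no λ ()
  link? 2 (suc (suc (suc t))) with suc t ℕP.≟ d | t ℕP.≟ d
  ... | yes t-last | _         = yes (hub-left t t-last)
  ... | no _       | yes refl  = yes hub-right
  ... | no ¬left   | no ¬right = no λ where
    (hub-left _ t-last) → ¬left t-last
    hub-right           → ¬right refl
  link? (suc (suc (suc t))) j =
    map′ (λ { (refl , same) → path t same }) (λ { (path _ same) → refl , same })
         ((j ℕP.≟ 4 + t) ×-dec (t / d ℕP.≟ suc t / d))

  link-< : ∀ {i j} → Link i j → i < j
  link-< (top-link _)    = z<s
  link-< (bottom-link _) = s≤s z<s
  link-< (hub-left _ _)  = s≤s (s≤s z<s)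
  link-< hub-right       = s≤s (s≤s z<s)
  link-< (path t _)      = ℕP.n<1+n (3 + t)

  Edge : ℕ → ℕ → Set
  Edge i j = Link i j ⊎ Link j i

  edge? : ∀ i j → Dec (Edge i j)
  edge? i j = link? i j ⊎-dec link? j i

  graph : (n : ℕ) → Graph n
  graph n = record
    { adj    = λ u v → does (edge? (toℕ u) (toℕ v))
    ; sym    = λ u v → ∨-comm (does (link? (toℕ u) (toℕ v))) (does (link? (toℕ v) (toℕ u)))
    ; irrefl = λ u → dec-false (edge? (toℕ u) (toℕ u)) λ where
        (inj₁ l) → ℕP.<-irrefl refl (link-< l)
        (inj₂ l) → ℕP.<-irrefl refl (link-< l)
    }

  -- The hub takes axis position d, between blocks 0 and 1.
  position : ℕ → ℕ
  position t with t <? d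
  ... | yes _ = t
  ... | no  _ = suc t

  site : ℕ → Site
  site 0                   = top
  site 1                   = bottom
  site 2                   = axis d
  site (suc (suc (suc t))) = axis (position t)

  position≢d : ∀ t → position t ≢ d
  position≢d t with t <? d
  ... | yes t<d = ℕP.<⇒≢ t<d
  ... | no  t≮d = ℕP.<⇒≢ (s≤s (ℕP.≮⇒≥ t≮d)) ∘ ≡-sym

  position-injective : ∀ {t u} → position t ≡ position u → t ≡ u
  position-injective {t} {u} eq with t <? d | u <? d
  ... | yes _   | yes _   = eq
  ... | no  _   | no  _   = ℕP.suc-injective eq
  ... | yes t<d | no  u≮d =
    ⊥-elim (ℕP.<-irrefl eq (ℕP.<-≤-trans t<d (ℕP.m≤n⇒m≤1+n (ℕP.≮⇒≥ u≮d))))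
  ... | no  t≮d | yes u<d =
    ⊥-elim (ℕP.<-irrefl (≡-sym eq) (ℕP.<-≤-trans u<d (ℕP.m≤n⇒m≤1+n (ℕP.≮⇒≥ t≮d))))

  position-below : ∀ {t} → t < d → position t ≡ t
  position-below {t} t<d with t <? d
  ... | yes _   = refl
  ... | no  t≮d = ⊥-elim (t≮d t<d)

  position-hub : position d ≡ suc d
  position-hub with d <? d
  ... | yes d<d = ⊥-elim (ℕP.<-irrefl refl d<d)
  ... | no  _   = refl

  position-path : ∀ t → t / d ≡ suc t / d → position (suc t) ≡ suc (position t)
  position-path t same with t <? d | suc t <? d
  ... | yes _   | yes _     = refl
  ... | no  _   | no  _     = refl
  ... | no  t≮d | yes t+1<d = ⊥-elim (t≮d (ℕP.<-trans (ℕP.n<1+n t) t+1<d))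
  ... | yes t<d | no  t+1≮d = ⊥-elim (ℕP.0≢1+n (begin
    0           ≡⟨ m<n⇒m/n≡0 t<d ⟨
    t / d       ≡⟨ same ⟩
    suc t / d   ≡⟨ cong (_/ d) (ℕP.≤-antisym t<d (ℕP.≮⇒≥ t+1≮d)) ⟩
    d / d       ≡⟨ n/n≡1 d ⟩
    1           ∎))
    where open ≡-Reasoning

  site-injective : ∀ {u v} → site u ≡ site v → u ≡ v
  site-injective {0} {0} _ = refl
  site-injective {1} {1} _ = refl
  site-injective {2} {2} _ = refl
  site-injective {suc (suc (suc t))} {suc (suc (suc u))} eq =
    cong (λ x → 3 + x) (position-injective (axis-injective eq))
  site-injective {2} {suc (suc (suc u))} eq = ⊥-elim (position≢d u (≡-sym (axis-injective eq)))
  site-injective {suc (suc (suc t))} {2} eq = ⊥-elim (position≢d t (axis-injective eq))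
  site-injective {0} {1} ()
  site-injective {0} {2} ()
  site-injective {0} {suc (suc (suc _))} ()
  site-injective {1} {0} ()
  site-injective {1} {2} ()
  site-injective {1} {suc (suc (suc _))} ()
  site-injective {2} {0} ()
  site-injective {2} {1} ()
  site-injective {suc (suc (suc _))} {0} ()
  site-injective {suc (suc (suc _))} {1} ()

  link-fan : ∀ {i j} → Link i j → FanEdge (site i) (site j) ⊎ FanEdge (site j) (site i)
  link-fan (top-link 0)             = inj₁ top-bottom
  link-fan (top-link 1)             = inj₁ (top-axis d)
  link-fan (top-link (suc (suc t))) = inj₁ (top-axis (position t))
  link-fan (bottom-link 0)          = inj₁ (bottom-axis d)
  link-fan (bottom-link (suc t))    = inj₁ (bottom-axis (position t))
  link-fan (hub-left t t-last)      = inj₂ (subst₂ (λ a b → FanEdge (axis a) (axis b))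
    (≡-sym (position-below (subst (t <_) t-last (ℕP.n<1+n t)))) t-last (axis-step t))
  link-fan hub-right                =
    inj₁ (subst (FanEdge (axis d) ∘ axis) (≡-sym position-hub) (axis-step d))
  link-fan (path t same)            =
    inj₁ (subst (FanEdge (axis (position t)) ∘ axis) (≡-sym (position-path t same))
                (axis-step (position t)))

  planar : ∀ n → Planar (graph n)
  planar n = fan-planar (graph n) (site ∘ toℕ) (toℕ-injective ∘ site-injective)
    λ u v u~v → [ link-fan , swap ∘ link-fan ]′ (true⇒witness (edge? (toℕ u) (toℕ v)) u~v)

  link-block : ∀ {i j} → Link i j → 3 ≤ i → (i ∸ 3) / d ≡ (j ∸ 3) / d
  link-block (path _ same)   _ = same
  link-block (top-link _)    ()
  link-block (bottom-link _) (s≤s ())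
  link-block (hub-left _ _)  (s≤s (s≤s ()))
  link-block hub-right       (s≤s (s≤s ()))

  blocks : ∀ n → BlockDecomposition (graph n) (λ v → toℕ v < 3) d
  blocks n = record
    { block           = λ v → (toℕ v ∸ 3) / d
    ; slot            = λ v → (toℕ v ∸ 3) mod d
    ; block-edge      = λ {u} {v} u≮3 v≮3 u~v →
        [ (λ l → link-block l (ℕP.≮⇒≥ u≮3)) , (λ l → ≡-sym (link-block l (ℕP.≮⇒≥ v≮3))) ]′
          (true⇒witness (edge? (toℕ u) (toℕ v)) u~v)
    ; label-injective = λ u≮3 v≮3 block≡ slot≡ →
        toℕ-injective (ℕP.∸-cancelʳ-≡ (ℕP.≮⇒≥ u≮3) (ℕP.≮⇒≥ v≮3) (/-%-injective d block≡
          (trans (≡-sym (toℕ-fromℕ< _)) (trans (cong toℕ slot≡) (toℕ-fromℕ< _)))))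
    }

  2C-free : ∀ n → ¬ Contains2C (2 + d) (graph n)
  2C-free n =
    meets-twice⇒¬Contains2C {G = graph n} (cycle-meets-twice (λ v → toℕ v <? 3) (blocks n))

  link-count : ℕ → ℕ
  link-count n = ∑ n λ i → ∑ n λ j → 𝟙 (does (link? i j))

  link-count≤edgeCount : ∀ n → link-count n ≤ edgeCount (graph n)
  link-count≤edgeCount n = subst (link-count n ≤_) (≡-sym (double-sum-allFin n _))
    (∑-mono-≤ n λ {i} _ → ∑-mono-≤ n λ {j} _ → counted i j)
    where
      counted : ∀ i j → 𝟙 (does (link? i j)) ≤ 𝟙 ((i <ᵇ j) ∧ does (edge? i j))
      counted i j with link? i j
      ... | no _  = z≤n
      ... | yes l with i <ᵇ j | ℕP.<⇒<ᵇ (link-< l)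
      ...   | true | _ = ℕP.≤-refl

  path-count : ℕ → ℕ
  path-count m = ∑ m λ t → 𝟙 (does (t / d ℕP.≟ suc t / d))

  path-count+m/d≡m : ∀ m → path-count m + m / d ≡ m
  path-count+m/d≡m zero = 0/n≡0 d
  path-count+m/d≡m (suc m) with /-suc m d
  ... | inj₁ same = begin
    path-count (suc m) + suc m / d
      ≡⟨ cong₂ _+_ (∑-suc m _) same ⟩
    path-count m + 𝟙 (does (m / d ℕP.≟ suc m / d)) + m / d
      ≡⟨ cong (λ b → path-count m + 𝟙 b + m / d)
              (dec-true (m / d ℕP.≟ suc m / d) (≡-sym same)) ⟩
    path-count m + 1 + m / d
      ≡⟨ cong (_+ m / d) (ℕP.+-comm (path-count m) 1) ⟩
    suc (path-count m + m / d)
      ≡⟨ cong suc (path-count+m/d≡m m) ⟩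
    suc m ∎
    where open ≡-Reasoning
  ... | inj₂ next = begin
    path-count (suc m) + suc m / d
      ≡⟨ cong₂ _+_ (∑-suc m _) next ⟩
    path-count m + 𝟙 (does (m / d ℕP.≟ suc m / d)) + suc (m / d)
      ≡⟨ cong (λ b → path-count m + 𝟙 b + suc (m / d))
              (dec-false (m / d ℕP.≟ suc m / d) (λ eq → ℕP.1+n≢n (≡-sym (trans eq next)))) ⟩
    path-count m + 0 + suc (m / d)
      ≡⟨ cong (_+ suc (m / d)) (ℕP.+-identityʳ (path-count m)) ⟩
    path-count m + suc (m / d)
      ≡⟨ ℕP.+-suc (path-count m) (m / d) ⟩
    suc (path-count m + m / d)
      ≡⟨ cong suc (path-count+m/d≡m m) ⟩
    suc m ∎
    where open ≡-Reasoning

  path-indicator : ∀ t → 𝟙 (does (link? (3 + t) (4 + t))) ≡ 𝟙 (does (t / d ℕP.≟ suc t / d))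
  path-indicator t = cong 𝟙 (does-⇔ (mk⇔ (λ { (path _ same) → same }) (path t))
                                     (link? (3 + t) (4 + t)) (t / d ℕP.≟ suc t / d))

  link-count-≥ : ∀ m → d ≤ m → (3 + m) + ((2 + m) + (2 + path-count m)) ≤ link-count (4 + m)
  link-count-≥ m d≤m =
    ℕP.+-mono-≤ (ℕP.≤-reflexive (≡-sym (∑-ones (3 + m))))
      (ℕP.+-mono-≤ (ℕP.≤-reflexive (≡-sym (∑-ones (2 + m))))
        (ℕP.+-mono-≤ hub-row path-rows))
    where
      row : ℕ → ℕ
      row i = ∑ (4 + m) λ j → 𝟙 (does (link? i j))

      hub-row : 2 ≤ row 2
      hub-row = subst₂ (λ x y → x + y ≤ row 2)
        (cong 𝟙 (dec-true (link? 2 (3 + pred d)) (hub-left (pred d) (ℕP.suc-pred d))))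
        (cong 𝟙 (dec-true (link? 2 (3 + d)) hub-right))
        (two-terms≤∑ (4 + m) (λ j → 𝟙 (does (link? 2 j)))
          (ℕP.+-monoʳ-< 3 (subst (pred d <_) (ℕP.suc-pred d) (ℕP.n<1+n (pred d))))
          (ℕP.+-monoʳ-≤ 4 d≤m))

      path-rows : path-count m ≤ ∑ (1 + m) λ t → row (3 + t)
      path-rows = ℕP.≤-trans
        (∑-mono-≤ m λ {t} t<m → ℕP.≤-trans (ℕP.≤-reflexive (≡-sym (path-indicator t)))
          (term≤∑ (4 + m) (λ j → 𝟙 (does (link? (3 + t) j))) (ℕP.+-monoʳ-< 4 t<m)))
        (∑≤∑-suc m λ t → row (3 + t))

-- Arithmetic of the bound

edge-identity : ∀ d i q → (2 + 3 * d) * (4 + (i + q * suc d)) + (4 + i)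
  ≡ 5 * suc d + suc d * ((3 + (i + q * suc d)) + ((2 + (i + q * suc d)) + (2 + (i + q * d))))
edge-identity = ℕ-Ring.solve-∀

bound-identity : ∀ d m c → c + m / suc d ≡ m →
  let r = suc m % suc d in
  (3 * suc d ∸ 1) * (4 + m) + (3 + r) + suc d * (1 ∸ r)
    ≡ 5 * suc d + suc d * ((3 + m) + ((2 + m) + (2 + c)))
bound-identity d m c c+q≡m = begin
  (3 * suc d ∸ 1) * (4 + m) + (3 + r) + suc d * (1 ∸ r)
    ≡⟨ ℕP.+-assoc ((3 * suc d ∸ 1) * (4 + m)) (3 + r) _ ⟩
  (3 * suc d ∸ 1) * (4 + m) + (3 + (r + suc d * (1 ∸ r)))
    ≡⟨ cong₂ (λ a w → a * (4 + m) + (3 + w))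
             (cong (_∸ 1) (ℕP.*-suc 3 d)) (suc-%-unwrap m (suc d)) ⟩
  (2 + 3 * d) * (4 + m) + (4 + i)
    ≡⟨ substitute m c (m≡m%n+[m/n]*n m (suc d)) c≡i+qd ⟩
  5 * suc d + suc d * ((3 + m) + ((2 + m) + (2 + c))) ∎
  where
    open ≡-Reasoning
    r = suc m % suc d
    i = m % suc d
    q = m / suc d
    regroup : ∀ d i q → i + q * suc d ≡ (i + q * d) + q
    regroup = ℕ-Ring.solve-∀
    c≡i+qd : c ≡ i + q * d
    c≡i+qd = ℕP.+-cancelʳ-≡ q c (i + q * d)
               (trans c+q≡m (trans (m≡m%n+[m/n]*n m (suc d)) (regroup d i q)))
    substitute : ∀ m c → m ≡ i + q * suc d → c ≡ i + q * d →
      (2 + 3 * d) * (4 + m) + (4 + i) ≡ 5 * suc d + suc d * ((3 + m) + ((2 + m) + (2 + c)))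
    substitute _ _ refl refl = edge-identity d i q

+-rearrange : ∀ a n b c e x → a * n + b + e ≡ c + x →
  + a ℤ.* + n ℤ.+ + b ℤ.- + c ℤ.+ + e ≡ + x
+-rearrange a n b c e x eq = begin
  + a ℤ.* + n ℤ.+ + b ℤ.- + c ℤ.+ + e     ≡⟨ move-c (+ a) (+ n) (+ b) (+ c) (+ e) ⟩
  (+ a ℤ.* + n ℤ.+ + b ℤ.+ + e) ℤ.- + c   ≡⟨ cong (ℤ._- + c) embed ⟩
  + (a * n + b + e) ℤ.- + c               ≡⟨ cong (λ z → + z ℤ.- + c) eq ⟩
  + (c + x) ℤ.- + c                       ≡⟨ cong (ℤ._- + c) (ℤP.pos-+ c x) ⟩
  (+ c ℤ.+ + x) ℤ.- + c                   ≡⟨ cancel (+ c) (+ x) ⟩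
  + x                                     ∎
  where
    open ≡-Reasoning
    move-c : ∀ a n b c e → a ℤ.* n ℤ.+ b ℤ.- c ℤ.+ e ≡ (a ℤ.* n ℤ.+ b ℤ.+ e) ℤ.- c
    move-c = ℤ-Ring.solve-∀
    cancel : ∀ c x → (c ℤ.+ x) ℤ.- c ≡ x
    cancel = ℤ-Ring.solve-∀
    embed : + a ℤ.* + n ℤ.+ + b ℤ.+ + e ≡ + (a * n + b + e)
    embed = ≡-sym (trans (ℤP.pos-+ (a * n + b) e) (cong (ℤ._+ + e)
              (trans (ℤP.pos-+ (a * n) b) (cong (ℤ._+ + b) (ℤP.pos-* a n)))))

bound≤ : ∀ d m c e → c + m / suc d ≡ m → (3 + m) + ((2 + m) + (2 + c)) ≤ e →
  let r = rem (suc m) (suc d) in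
  + (3 * suc d ∸ 1) ℤ.* + (4 + m) ℤ.+ + (3 + r) ℤ.- + (5 * suc d) ℤ.+ + (suc d * (1 ∸ r))
    ℤ.≤ + suc d ℤ.* + e
bound≤ d m c e c+q≡m E≤e =
  subst₂ ℤ._≤_ (≡-sym (+-rearrange (3 * suc d ∸ 1) (4 + m) (3 + r) (5 * suc d) (suc d * (1 ∸ r))
                                    _ (bound-identity d m c c+q≡m)))
               (ℤP.pos-* (suc d) e)
               (ℤ.+≤+ (ℕP.*-monoʳ-≤ (suc d) E≤e))
  where r = suc m % suc d

-- The construction only needs k ≥ 3.
parameter-shape : ∀ {n k} → 2 * k ≤ n → 8 ≤ 2 * k →
                  ∃ λ m → ∃ λ d → n ≡ 4 + m × k ≡ 3 + d × suc d ≤ m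
parameter-shape {k = 0} _ ()
parameter-shape {k = 1} _ (s≤s (s≤s ()))
parameter-shape {k = 2} _ (s≤s (s≤s (s≤s (s≤s ()))))
parameter-shape {n} {suc (suc (suc d))} 2k≤n _ =
  n ∸ 4 , d , ≡-sym (ℕP.m+[n∸m]≡n (ℕP.≤-trans (ℕP.m≤m+n 4 (suc d)) 5+d≤n)) , refl ,
  ℕP.∸-monoˡ-≤ 4 5+d≤n
  where
    5+d≤n : 5 + d ≤ n
    5+d≤n = ℕP.≤-trans (ℕP.+-monoʳ-≤ 5 (ℕP.m≤n⇒m≤1+n (ℕP.m≤m+n d (d + 0))))
              (subst (_≤ n) (ℕP.*-distribˡ-+ 2 3 d) 2k≤n)

lemma3p2 : (n k : ℕ) → 2 * k ≤ n → 8 ≤ 2 * k →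
    let r = rem (n ∸ 3) (k ∸ 2) in
    ExPAtLeast n k (λ e →
      ((+ (3 * (k ∸ 2) ∸ 1)) ℤ.* (+ n) ℤ.+ (+ (3 + r)) ℤ.- (+ (5 * (k ∸ 2)))
        ℤ.+ (+ ((k ∸ 2) * (1 ∸ r))))
      ℤ.≤ (+ (k ∸ 2)) ℤ.* (+ e))
lemma3p2 n k 2k≤n 8≤2k with parameter-shape {n} {k} 2k≤n 8≤2k
... | m , d , refl , refl , d<m =
  graph (4 + m) , planar (4 + m) , 2C-free (4 + m) ,
  bound≤ d m (path-count m) _ (path-count+m/d≡m m)
    (ℕP.≤-trans (link-count-≥ m d<m) (link-count≤edgeCount (4 + m)))
  where open Construction (suc d)
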